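{- Let $h\ge 3$ be an integer. Let $A=\{a_1,a_2,\ldots,a_{h+1}\}$ be a set of $h+1$ positive integers with $a_1<a_2<\cdots<a_{h+1}$, $a_3-a_2<2a_1$, and $a_i-a_{i-1}>\frac{a_2-a_1}{2}$ for $i=4,\ldots,h+1$. Then $\left|h^{\wedge}_{\pm}A\right|\ge (h+1)^2+1$.
   Context: For a positive integer $h$ and a finite set of integers $A=\{a_1,\ldots,a_k\}$ (distinct elements), the restricted $h$-fold signed sumset is $h^{\wedge}_{\pm}A=\left\{\sum_{i=1}^k\lambda_i a_i:\lambda_i\in\{ -1,0,1\},\ \sum_{i=1}^k|\lambda_i|=h\right\}$. -}

module Defs where

open import Data.Nat using (ℕ; zero; suc)
open import Data.Fin using (Fin; zero; suc)
open import Data.Integer using (ℤ; +_; -_; _+_; _*_; 0ℤ; 1ℤ)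
import Data.Integer.Properties as ℤP
open import Data.List using (List; []; _∷_; map; concatMap; sum; length; filterᵇ; deduplicate)
open import Data.Bool using (Bool)
open import Relation.Nullary.Decidable using (⌊_⌋)
import Data.Nat as N

data Sgn : Set where
  neg zer pos : Sgn

sgnVal : Sgn → ℤ
sgnVal neg = - 1ℤ
sgnVal zer = 0ℤ
sgnVal pos = 1ℤ

sgnAbs : Sgn → ℕ
sgnAbs zer = 0
sgnAbs neg = 1
sgnAbs pos = 1

allCoeffs : ℕ → List (List Sgn)
allCoeffs zero = [] ∷ []
allCoeffs (suc k) = concatMap (λ l → map (λ s → s ∷ l) (neg ∷ zer ∷ pos ∷ [])) (allCoeffs k)

elems : ∀ {k} → (Fin k → ℤ) → List ℤ
elems {zero} a = []
elems {suc k} a = a zero ∷ elems (λ i → a (suc i))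

weight : List Sgn → ℕ
weight [] = 0
weight (s ∷ l) = sgnAbs s N.+ weight l

signedSum : List Sgn → List ℤ → ℤ
signedSum (s ∷ l) (x ∷ xs) = sgnVal s * x + signedSum l xs
signedSum _ _ = 0ℤ

restrictedSignedSumset : ∀ {k} → ℕ → (Fin k → ℤ) → List ℤ
restrictedSignedSumset {k} h a =
  deduplicate ℤP._≟_
    (map (λ l → signedSum l (elems a))
         (filterᵇ (λ l → ⌊ weight l N.≟ h ⌋) (allCoeffs k)))

-- a at natural index i (0-based); only used at indices known to be in range
at : ∀ {k} → (Fin k → ℤ) → ℕ → ℤ
at {zero} a i = 0ℤ
at {suc k} a zero = a zero
at {suc k} a (suc i) = at (λ j → a (suc j)) i

-- Write x₀ < x₁ < … < x_h for the elements and d = x₁ − x₀. By induction on n ≥ 2 we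
-- find, among the n-fold restricted signed sums of x₀, …, xₙ, a set C of (n+1)² + 1
-- values and a set T of 2n + 3 values, together with a sum L such that L + d is also a
-- sum, C ≥ L and L ≤ T ≤ L + 2xₙ + d. Adding b = xₙ₊₁ maps C to C + b ≥ L + b and
-- T to T − b ≤ L + 2xₙ + d − b < L + b, the last step being the hypothesis
-- d < 2(xₙ₊₁ − xₙ). So (C + b) ∪ (T − b) has (n+2)² + 1 distinct values, and
-- L′ = L − b, T′ = {L + d + b, L + b} ∪ (T − b) keep the invariant. For n = 2, ten of
-- the sums ±xᵢ ± xⱼ are listed in decreasing order; x₂ − x₁ < 2x₀ is what orders them.

module Submission where

open import Defs
open import Data.Nat using (ℕ; suc; _≤_; _^_)
open import Data.Fin using (Fin; _<_)
open import Data.Integer using (ℤ; +_; _-_; _*_)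
import Data.Integer as ℤ
open import Data.List using (length)

open import Data.Nat using (zero; z≤n; s≤s)
import Data.Nat as N
import Data.Nat.Properties as NP
open import Data.Nat.Tactic.RingSolver as ℕ-Solver using ()
open import Data.Fin using (zero; suc; fromℕ<)
open import Data.Integer using (0ℤ; -_; _+_)
import Data.Integer.Properties as ZP
open import Data.Integer.Tactic.RingSolver using (solve)
open import Data.List using (List; []; _∷_; _++_; _∷ʳ_; map)
import Data.List.Properties as LP
open import Data.List.Relation.Unary.All using (All; []; _∷_)
import Data.List.Relation.Unary.All as All
import Data.List.Relation.Unary.All.Properties as AllP
open import Data.List.Relation.Unary.AllPairs using (AllPairs; []; _∷_)
import Data.List.Relation.Unary.AllPairs as AllPairs
import Data.List.Relation.Unary.AllPairs.Properties as AllPairsP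
open import Data.List.Relation.Unary.Linked using (Linked; [-]; _∷_)
open import Data.List.Relation.Unary.Linked.Properties using (Linked⇒AllPairs)
open import Data.List.Relation.Unary.Unique.Propositional using (Unique)
open import Data.List.Relation.Unary.Any using (here; there; index; _─_)
open import Data.List.Relation.Binary.Subset.Propositional using (_⊆_)
open import Data.List.Membership.Propositional using (_∈_)
open import Data.List.Membership.Propositional.Properties
  using (∈-map⁺; ∈-concat⁺′; ∈-filter⁺; ∈-deduplicate⁺)
open import Data.Product using (_×_; _,_; proj₂; ∃-syntax)
open import Data.Empty using (⊥-elim)
open import Relation.Binary.PropositionalEquality
  using (_≡_; _≢_; refl; sym; trans; cong; cong₂; subst; subst₂; module ≡-Reasoning)
open import Relation.Nullary.Decidable using (fromWitness; ⌊_⌋)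
open import Algebra.Properties.CommutativeSemigroup ZP.+-commutativeSemigroup using (xy∙z≈xz∙y)
open import Relation.Nullary.Decidable.Core using (T?)

∈-─ : ∀ {A : Set} {x y : A} {xs} (x∈xs : x ∈ xs) → y ∈ xs → y ≢ x → y ∈ (xs ─ x∈xs)
∈-─ (here refl) (here refl) y≢x = ⊥-elim (y≢x refl)
∈-─ (here refl) (there y∈xs) _ = y∈xs
∈-─ (there _) (here refl) _ = here refl
∈-─ (there x∈xs) (there y∈xs) y≢x = there (∈-─ x∈xs y∈xs y≢x)

unique-⊆⇒length≤ : ∀ {A : Set} {xs ys : List A} → Unique xs → xs ⊆ ys → length xs ≤ length ys
unique-⊆⇒length≤ [] _ = z≤n
unique-⊆⇒length≤ {xs = x ∷ xs} {ys} (x∉xs ∷ xs!) xs⊆ys =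
  subst (suc (length xs) ≤_) (sym (LP.length-removeAt′ ys (index x∈ys)))
    (s≤s (unique-⊆⇒length≤ xs! λ y∈xs →
      ∈-─ x∈ys (xs⊆ys (there y∈xs)) λ y≡x → All.lookup x∉xs y∈xs (sym y≡x)))
  where
  x∈ys : x ∈ ys
  x∈ys = xs⊆ys (here refl)

i<j⇒0<j-i : ∀ {i j} → i ℤ.< j → 0ℤ ℤ.< j - i
i<j⇒0<j-i {i} {j} i<j = subst (ℤ._< j - i) (ZP.+-inverseʳ i) (ZP.+-monoˡ-< (- i) i<j)

i<i+j : ∀ i {j} → 0ℤ ℤ.< j → i ℤ.< i + j
i<i+j i 0<j = subst (ℤ._< i + _) (ZP.+-identityʳ i) (ZP.+-monoʳ-< i 0<j)

Descending : List ℤ → Set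
Descending = AllPairs ℤ._>_

descending-map : ∀ {f : ℤ → ℤ} {xs} → (∀ {i j} → i ℤ.< j → f i ℤ.< f j) →
                 Descending xs → Descending (map f xs)
descending-map f-mono xs↓ = AllPairsP.map⁺ (AllPairs.map f-mono xs↓)

descending-++ : ∀ {xs ys} p → Descending xs → Descending ys →
                All (p ℤ.≤_) xs → All (ℤ._< p) ys → Descending (xs ++ ys)
descending-++ p xs↓ ys↓ p≤xs ys<p =
  AllPairsP.++⁺ xs↓ ys↓ (All.map (λ p≤x → All.map (λ y<p → ZP.<-≤-trans y<p p≤x) ys<p) p≤xs)

descending⇒≤head : ∀ {x xs} → Descending (x ∷ xs) → All (ℤ._≤ x) (x ∷ xs)
descending⇒≤head (x>xs ∷ _) = ZP.≤-refl ∷ All.map ZP.<⇒≤ x>xs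

descending⇒≥last : ∀ xs {y} → Descending (xs ∷ʳ y) → All (y ℤ.≤_) (xs ∷ʳ y)
descending⇒≥last [] _ = ZP.≤-refl ∷ []
descending⇒≥last (x ∷ xs) (x>xs∷ʳy ∷ xs∷ʳy↓) =
  ZP.<⇒≤ (proj₂ (AllP.∷ʳ⁻ x>xs∷ʳy)) ∷ descending⇒≥last xs xs∷ʳy↓

descending⇒unique : ∀ {xs} → Descending xs → Unique xs
descending⇒unique = AllPairs.map λ x>y x≡y → ZP.<⇒≢ x>y (sym x≡y)

SignedSum : List ℤ → ℕ → ℕ → ℤ → Set
SignedSum xs k w v = ∃[ λs ] length λs ≡ k × weight λs ≡ w × signedSum λs xs ≡ v

weight-∷ʳ : ∀ (λs : List Sgn) s → weight (λs ∷ʳ s) ≡ weight λs N.+ sgnAbs s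
weight-∷ʳ [] s = NP.+-identityʳ (sgnAbs s)
weight-∷ʳ (t ∷ λs) s =
  trans (cong (sgnAbs t N.+_) (weight-∷ʳ λs s)) (sym (NP.+-assoc (sgnAbs t) (weight λs) (sgnAbs s)))

length-∷ʳ : ∀ {A : Set} (xs : List A) x → length (xs ∷ʳ x) ≡ suc (length xs)
length-∷ʳ xs x = trans (LP.length-++ xs) (NP.+-comm (length xs) 1)

signedSum-∷ʳ : ∀ {k} (a : Fin k → ℤ) (λs : List Sgn) s → suc (length λs) ≤ k →
               signedSum (λs ∷ʳ s) (elems a) ≡ signedSum λs (elems a) + sgnVal s * at a (length λs)
signedSum-∷ʳ {suc k} a [] s _ = ZP.+-comm (sgnVal s * a zero) 0ℤ
signedSum-∷ʳ {suc k} a (t ∷ λs) s (s≤s len<k) =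
  trans (cong (_+_ (sgnVal t * a zero)) (signedSum-∷ʳ (λ i → a (suc i)) λs s len<k))
        (sym (ZP.+-assoc (sgnVal t * a zero) _ _))

module _ {K} (a : Fin K → ℤ) where

  SignedSum-∷ʳ : ∀ {k w v} s → suc k ≤ K → SignedSum (elems a) k w v →
                 SignedSum (elems a) (suc k) (w N.+ sgnAbs s) (v + sgnVal s * at a k)
  SignedSum-∷ʳ s k<K (λs , refl , refl , refl) =
    λs ∷ʳ s , length-∷ʳ λs s , weight-∷ʳ λs s , signedSum-∷ʳ a λs s k<K

  SignedSum-+ : ∀ {k w v} → suc k ≤ K → SignedSum (elems a) k w v →
                SignedSum (elems a) (suc k) (suc w) (v + at a k)
  SignedSum-+ {k} {w} {v} k<K σ =
    subst₂ (SignedSum (elems a) (suc k)) (NP.+-comm w 1) (cong (_+_ v) (ZP.*-identityˡ (at a k)))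
      (SignedSum-∷ʳ pos k<K σ)

  SignedSum-- : ∀ {k w v} → suc k ≤ K → SignedSum (elems a) k w v →
                SignedSum (elems a) (suc k) (suc w) (v - at a k)
  SignedSum-- {k} {w} {v} k<K σ =
    subst₂ (SignedSum (elems a) (suc k)) (NP.+-comm w 1) (cong (_+_ v) (ZP.-1*i≡-i (at a k)))
      (SignedSum-∷ʳ neg k<K σ)

allCoeffs-complete : ∀ (λs : List Sgn) → λs ∈ allCoeffs (length λs)
allCoeffs-complete [] = here refl
allCoeffs-complete (s ∷ λs) =
  ∈-concat⁺′ (extension s) (∈-map⁺ (λ l → map (_∷ l) (neg ∷ zer ∷ pos ∷ [])) (allCoeffs-complete λs))
  where
  extension : ∀ s → s ∷ λs ∈ map (_∷ λs) (neg ∷ zer ∷ pos ∷ [])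
  extension neg = here refl
  extension zer = there (here refl)
  extension pos = there (there (here refl))

SignedSum⇒∈restrictedSignedSumset : ∀ {k h v} (a : Fin k → ℤ) →
  SignedSum (elems a) k h v → v ∈ restrictedSignedSumset h a
SignedSum⇒∈restrictedSignedSumset {h = h} a (λs , refl , refl , refl) =
  ∈-deduplicate⁺ ZP._≟_ (∈-map⁺ (λ l → signedSum l (elems a))
    (∈-filter⁺ (λ l → T? ⌊ weight l N.≟ h ⌋) (allCoeffs-complete λs) (fromWitness refl)))

at-fromℕ< : ∀ {k n} (a : Fin k → ℤ) (n<k : suc n ≤ k) → at a n ≡ a (fromℕ< n<k)
at-fromℕ< {suc k} {zero} a _ = refl
at-fromℕ< {suc k} {suc n} a (s≤s n<k) = at-fromℕ< (λ i → a (suc i)) n<k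

record Window (L B : ℤ) (C T : List ℤ) : Set where
  field
    C-desc : Descending C
    T-desc : Descending T
    C-above : All (L ℤ.≤_) C
    T-above : All (L ℤ.≤_) T
    T-below : All (ℤ._≤ B) T

window-shift : ∀ {L d y b C T} → 0ℤ ℤ.< d → 0ℤ ℤ.< b → d ℤ.< + 2 * (b - y) →
  Window L (L + + 2 * y + d) C T →
  Window (L - b) (L - b + + 2 * b + d)
         (map (λ c → c + b) C ++ map (λ t → t - b) T)
         (L + d + b ∷ L + b ∷ map (λ t → t - b) T)
window-shift {L} {d} {y} {b} {C} {T} 0<d 0<b gap W = record
  { C-desc = descending-++ (L + b) (descending-map (ZP.+-monoˡ-< b) C-desc) T⁻-desc C⁺-above T⁻-below
  ; T-desc = T′-desc
  ; C-above = AllP.++⁺ (All.map (ZP.≤-trans L-b≤L+b) C⁺-above) T⁻-above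
  ; T-above = ZP.≤-trans L-b≤L+b (ZP.<⇒≤ L+b<L+d+b) ∷ L-b≤L+b ∷ T⁻-above
  ; T-below = subst (λ B → All (ℤ._≤ B) T′) top≡bound (descending⇒≤head T′-desc)
  }
  where
  open Window W
  open ZP.≤-Reasoning

  vars : List ℤ
  vars = L ∷ d ∷ y ∷ b ∷ []

  T′ : List ℤ
  T′ = L + d + b ∷ L + b ∷ map (λ t → t - b) T

  shifted-bound<L+b : L + + 2 * y + d - b ℤ.< L + b
  shifted-bound<L+b = begin-strict
    L + + 2 * y + d - b              ≡⟨ solve vars ⟩
    L + + 2 * y - b + d              <⟨ ZP.+-monoʳ-< (L + + 2 * y - b) gap ⟩
    L + + 2 * y - b + + 2 * (b - y)  ≡⟨ solve vars ⟩
    L + b                            ∎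

  top≡bound : L + d + b ≡ L - b + + 2 * b + d
  top≡bound = solve vars

  L-b≤L+b : L - b ℤ.≤ L + b
  L-b≤L+b = ZP.+-monoʳ-≤ L (ZP.≤-trans (ZP.neg-mono-≤ (ZP.<⇒≤ 0<b)) (ZP.<⇒≤ 0<b))

  L+b<L+d+b : L + b ℤ.< L + d + b
  L+b<L+d+b = ZP.+-monoˡ-< b (i<i+j L 0<d)

  C⁺-above : All (L + b ℤ.≤_) (map (λ c → c + b) C)
  C⁺-above = AllP.map⁺ (All.map (ZP.+-monoˡ-≤ b) C-above)

  T⁻-desc : Descending (map (λ t → t - b) T)
  T⁻-desc = descending-map (ZP.+-monoˡ-< (- b)) T-desc

  T⁻-above : All (L - b ℤ.≤_) (map (λ t → t - b) T)
  T⁻-above = AllP.map⁺ (All.map (ZP.+-monoˡ-≤ (- b)) T-above)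

  T⁻-below : All (ℤ._< L + b) (map (λ t → t - b) T)
  T⁻-below = AllP.map⁺ (All.map (λ t≤B → ZP.≤-<-trans (ZP.+-monoˡ-≤ (- b) t≤B) shifted-bound<L+b) T-below)

  T′-desc : Descending T′
  T′-desc = descending-++ (L + b) ((L+b<L+d+b ∷ []) ∷ [] ∷ []) T⁻-desc
              (ZP.<⇒≤ L+b<L+d+b ∷ ZP.≤-refl ∷ []) T⁻-below

square-step : ∀ n → ((1 N.+ n) N.* (1 N.+ n) N.+ 1) N.+ (2 N.* (1 N.+ n) N.+ 1) ≡ (2 N.+ n) N.* (2 N.+ n) N.+ 1
square-step = ℕ-Solver.solve-∀

odd-step : ∀ n → 2 N.+ (2 N.* (1 N.+ n) N.+ 1) ≡ 2 N.* (2 N.+ n) N.+ 1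
odd-step = ℕ-Solver.solve-∀

module _ {K} (a : Fin K → ℤ) where

  private
    x : ℕ → ℤ
    x = at a

    d : ℤ
    d = x 1 - x 0

  InSumset : ℕ → ℤ → Set
  InSumset n = SignedSum (elems a) (suc n) n

  record Stage (n : ℕ) : Set where
    field
      low : ℤ
      C T : List ℤ
      low-sum : InSumset n low
      low+d-sum : InSumset n (low + d)
      C-sums : All (InSumset n) C
      T-sums : All (InSumset n) T
      C-length : length C ≡ suc n N.* suc n N.+ 1
      T-length : length T ≡ 2 N.* suc n N.+ 1
      window : Window low (low + + 2 * x n + d) C T

  stage-suc : ∀ {n} → suc (suc n) ≤ K → 0ℤ ℤ.< d → 0ℤ ℤ.< x (suc n) →
              d ℤ.< + 2 * (x (suc n) - x n) → Stage n → Stage (suc n)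
  stage-suc {n} n+1<K 0<d 0<b gap S = record
    { low = low - b
    ; C = map (λ c → c + b) C ++ map (λ t → t - b) T
    ; T = low + d + b ∷ low + b ∷ map (λ t → t - b) T
    ; low-sum = SignedSum-- a n+1<K low-sum
    ; low+d-sum = subst (InSumset (suc n)) (xy∙z≈xz∙y low d (- b)) (SignedSum-- a n+1<K low+d-sum)
    ; C-sums = AllP.++⁺ (sums⁺ C-sums) (sums⁻ T-sums)
    ; T-sums = SignedSum-+ a n+1<K low+d-sum ∷ SignedSum-+ a n+1<K low-sum ∷ sums⁻ T-sums
    ; C-length = C′-length
    ; T-length = trans (cong (λ m → suc (suc m)) (trans (LP.length-map _ T) T-length)) (odd-step n)
    ; window = window-shift 0<d 0<b gap window
    }
    where
    open Stage S
    b : ℤ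
    b = x (suc n)

    sums⁺ : ∀ {vs} → All (InSumset n) vs → All (InSumset (suc n)) (map (λ c → c + b) vs)
    sums⁺ σs = AllP.map⁺ (All.map (SignedSum-+ a n+1<K) σs)

    sums⁻ : ∀ {vs} → All (InSumset n) vs → All (InSumset (suc n)) (map (λ t → t - b) vs)
    sums⁻ σs = AllP.map⁺ (All.map (SignedSum-- a n+1<K) σs)

    C′-length : length (map (λ c → c + b) C ++ map (λ t → t - b) T) ≡ suc (suc n) N.* suc (suc n) N.+ 1
    C′-length = begin
      length (map (λ c → c + b) C ++ map (λ t → t - b) T)
        ≡⟨ LP.length-++ (map (λ c → c + b) C) ⟩
      length (map (λ c → c + b) C) N.+ length (map (λ t → t - b) T)
        ≡⟨ cong₂ N._+_ (LP.length-map _ C) (LP.length-map _ T) ⟩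
      length C N.+ length T
        ≡⟨ cong₂ N._+_ C-length T-length ⟩
      (suc n N.* suc n N.+ 1) N.+ (2 N.* suc n N.+ 1)
        ≡⟨ square-step n ⟩
      suc (suc n) N.* suc (suc n) N.+ 1 ∎
      where open ≡-Reasoning

module Sumset₃ (x0 x1 x2 : ℤ) where

  lowest : ℤ
  lowest = - x1 - x2

  T₃-upper : List ℤ
  T₃-upper = x2 - x0 ∷ x1 - x0 ∷ x1 - x2 ∷ x0 - x2 ∷ - x0 - x1 ∷ - x0 - x2 ∷ []

  T₃ : List ℤ
  T₃ = T₃-upper ∷ʳ lowest

  C₃ : List ℤ
  C₃ = x1 + x2 ∷ x0 + x2 ∷ x0 + x1 ∷ T₃

  private
    vars : List ℤ
    vars = x0 ∷ x1 ∷ x2 ∷ []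

  window₃ : x0 ℤ.< x1 → x1 ℤ.< x2 → x2 - x1 ℤ.< + 2 * x0 →
            Window lowest (lowest + + 2 * x2 + (x1 - x0)) C₃ T₃
  window₃ x0<x1 x1<x2 gap = record
    { C-desc = C-desc
    ; T-desc = T-desc
    ; C-above = descending⇒≥last (x1 + x2 ∷ x0 + x2 ∷ x0 + x1 ∷ T₃-upper) C-desc
    ; T-above = descending⇒≥last T₃-upper T-desc
    ; T-below = subst (λ B → All (ℤ._≤ B) T₃) top≡bound (descending⇒≤head T-desc)
    }
    where
    open ZP.≤-Reasoning

    >-trans : ∀ {i j k} → i ℤ.> j → j ℤ.> k → i ℤ.> k
    >-trans i>j j>k = ZP.<-trans j>k i>j

    x2-x0<x0+x1 : x2 - x0 ℤ.< x0 + x1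
    x2-x0<x0+x1 = begin-strict
      x2 - x0                ≡⟨ solve vars ⟩
      x2 - x1 + (x1 - x0)    <⟨ ZP.+-monoˡ-< (x1 - x0) gap ⟩
      + 2 * x0 + (x1 - x0)   ≡⟨ solve vars ⟩
      x0 + x1                ∎

    -x0-x1<x0-x2 : - x0 - x1 ℤ.< x0 - x2
    -x0-x1<x0-x2 = begin-strict
      - x0 - x1              ≡⟨ solve vars ⟩
      x2 - x1 + (- x0 - x2)  <⟨ ZP.+-monoˡ-< (- x0 - x2) gap ⟩
      + 2 * x0 + (- x0 - x2) ≡⟨ solve vars ⟩
      x0 - x2                ∎

    T-chain : Linked ℤ._>_ T₃
    T-chain = ZP.+-monoˡ-< (- x0) x1<x2
            ∷ ZP.+-monoʳ-< x1 (ZP.neg-mono-< (ZP.<-trans x0<x1 x1<x2))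
            ∷ ZP.+-monoˡ-< (- x2) x0<x1
            ∷ -x0-x1<x0-x2
            ∷ ZP.+-monoʳ-< (- x0) (ZP.neg-mono-< x1<x2)
            ∷ ZP.+-monoˡ-< (- x2) (ZP.neg-mono-< x0<x1)
            ∷ [-]

    T-desc : Descending T₃
    T-desc = Linked⇒AllPairs >-trans T-chain

    C-desc : Descending C₃
    C-desc = Linked⇒AllPairs >-trans
      (ZP.+-monoˡ-< x2 x0<x1 ∷ ZP.+-monoʳ-< x0 x1<x2 ∷ x2-x0<x0+x1 ∷ T-chain)

    top≡bound : x2 - x0 ≡ - x1 - x2 + + 2 * x2 + (x1 - x0)
    top≡bound = solve vars

  module _ (rest : List ℤ) where

    private
      signed₃ : ∀ v s₀ s₁ s₂ → sgnVal s₀ * x0 + (sgnVal s₁ * x1 + (sgnVal s₂ * x2 + 0ℤ)) ≡ v →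
                SignedSum (x0 ∷ x1 ∷ x2 ∷ rest) 3 (weight (s₀ ∷ s₁ ∷ s₂ ∷ [])) v
      signed₃ v s₀ s₁ s₂ eq = s₀ ∷ s₁ ∷ s₂ ∷ [] , refl , refl , eq

    lowest-sum : SignedSum (x0 ∷ x1 ∷ x2 ∷ rest) 3 2 lowest
    lowest-sum = signed₃ (- x1 - x2) zer neg neg (solve vars)

    lowest+d-sum : SignedSum (x0 ∷ x1 ∷ x2 ∷ rest) 3 2 (lowest + (x1 - x0))
    lowest+d-sum = signed₃ (- x1 - x2 + (x1 - x0)) neg zer neg (solve vars)

    T₃-sums : All (SignedSum (x0 ∷ x1 ∷ x2 ∷ rest) 3 2) T₃
    T₃-sums = signed₃ (x2 - x0) neg zer pos (solve vars)
            ∷ signed₃ (x1 - x0) neg pos zer (solve vars)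
            ∷ signed₃ (x1 - x2) zer pos neg (solve vars)
            ∷ signed₃ (x0 - x2) pos zer neg (solve vars)
            ∷ signed₃ (- x0 - x1) neg neg zer (solve vars)
            ∷ signed₃ (- x0 - x2) neg zer neg (solve vars)
            ∷ lowest-sum
            ∷ []

    C₃-sums : All (SignedSum (x0 ∷ x1 ∷ x2 ∷ rest) 3 2) C₃
    C₃-sums = signed₃ (x1 + x2) zer pos pos (solve vars)
            ∷ signed₃ (x0 + x2) pos zer pos (solve vars)
            ∷ signed₃ (x0 + x1) pos pos zer (solve vars)
            ∷ T₃-sums

stage₂ : ∀ {k} (a : Fin (3 N.+ k) → ℤ) → at a 0 ℤ.< at a 1 → at a 1 ℤ.< at a 2 →
         at a 2 - at a 1 ℤ.< + 2 * at a 0 → Stage a 2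
stage₂ a a₀<a₁ a₁<a₂ gap = record
  { low = lowest
  ; C = C₃
  ; T = T₃
  ; low-sum = lowest-sum rest
  ; low+d-sum = lowest+d-sum rest
  ; C-sums = C₃-sums rest
  ; T-sums = T₃-sums rest
  ; C-length = refl
  ; T-length = refl
  ; window = window₃ a₀<a₁ a₁<a₂ gap
  }
  where
  open Sumset₃ (a zero) (a (suc zero)) (a (suc (suc zero)))
  rest : List ℤ
  rest = elems (λ i → a (suc (suc (suc i))))

stage⇒sumset-bound : ∀ {h} (a : Fin (suc h) → ℤ) → Stage a h →
                     suc h ^ 2 N.+ 1 ≤ length (restrictedSignedSumset h a)
stage⇒sumset-bound {h} a S =
  subst (_≤ length (restrictedSignedSumset h a))
    (trans C-length (cong (λ m → suc h N.* m N.+ 1) (sym (NP.*-identityʳ (suc h)))))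
    (unique-⊆⇒length≤ (descending⇒unique (Window.C-desc window))
      λ v∈C → SignedSum⇒∈restrictedSignedSumset a (All.lookup C-sums v∈C))
  where open Stage S

theorem2p10 : (h : ℕ) → 3 ≤ h → (a : Fin (suc h) → ℤ)
    → (∀ i → ℤ.+0 ℤ.< a i)
    → (∀ i j → i < j → a i ℤ.< a j)
    → at a 2 - at a 1 ℤ.< + 2 * at a 0
    → (∀ (n : ℕ) → 3 ≤ n → n ≤ h → at a 1 - at a 0 ℤ.< + 2 * (at a n - at a (n Data.Nat.∸ 1)))
    → (suc h) ^ 2 Data.Nat.+ 1 ≤ length (restrictedSignedSumset h a)
theorem2p10 zero () _ _ _ _ _
theorem2p10 (suc zero) (s≤s ()) _ _ _ _ _
theorem2p10 (suc (suc zero)) (s≤s (s≤s ())) _ _ _ _ _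
theorem2p10 h@(suc (suc (suc h′))) _ a positive increasing base-gap gap =
  stage⇒sumset-bound a (stage (suc h′) NP.≤-refl)
  where
  a₀<a₁ : at a 0 ℤ.< at a 1
  a₀<a₁ = increasing zero (suc zero) (s≤s z≤n)

  stage : ∀ m → 2 N.+ m ≤ h → Stage a (2 N.+ m)
  stage zero _ = stage₂ a a₀<a₁ (increasing (suc zero) (suc (suc zero)) (s≤s (s≤s z≤n))) base-gap
  stage (suc m) m+3≤h =
    stage-suc a (s≤s m+3≤h) (i<j⇒0<j-i a₀<a₁)
      (subst (0ℤ ℤ.<_) (sym (at-fromℕ< a (s≤s m+3≤h))) (positive _))
      (gap (3 N.+ m) (s≤s (s≤s (s≤s z≤n))) m+3≤h)
      (stage m (NP.≤-trans (NP.n≤1+n _) m+3≤h))
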